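{- For every rational $u$ (so $1-6u^2\neq 0$), let $p = u(9u^2+1)$, $q = 9u^2-4$, $r = u(9u^2-4)$, $s = 1-6u^2$ and $a = \frac{9u^2+16}{1-6u^2}$. Then $pq(p^2+q^2) = a\,rs(r^2+s^2)$; equivalently $A=p+q$, $B=r-s$, $C=p-q$, $D=r+s$ satisfy $A^4 + aB^4 = C^4 + aD^4$. -}

module Defs where

open import Data.Rational using (ℚ; _+_; _*_; _-_; _÷_; NonZero; 0ℚ; 1ℚ)
open import Data.Integer using (+_)
open import Data.Rational using (_/_)

c1 c4 c6 c9 c16 : ℚ
c1 = + 1 / 1
c4 = + 4 / 1
c6 = + 6 / 1
c9 = + 9 / 1
c16 = + 16 / 1

sq : ℚ → ℚ
sq x = x * x

fourth : ℚ → ℚ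
fourth x = sq (sq x)

pOf qOf rOf sOf : ℚ → ℚ
pOf u = u * (c9 * sq u + c1)
qOf u = c9 * sq u - c4
rOf u = u * (c9 * sq u - c4)
sOf u = c1 - c6 * sq u

aOf : (u : ℚ) → .{{NonZero (sOf u)}} → ℚ
aOf u = (c9 * sq u + c16) ÷ sOf u

module Submission where

-- * Well-definedness: 1 - 6u² ≠ 0 for rational u, because 6 is not the
--   square of a rational.  We prove the classical parity argument on
--   coprime naturals (6m² = n² forces 2 ∣ n, then 2 ∣ m), and transfer a
--   rational equation 6u² = 1 to numerator/denominator by cross-multiplying.
-- * First identity: a·s = 9u² + 16 by definition of a, and the polynomial
--   identity (9u²+16)·r(r²+s²) = pq(p²+q²) in u is checked by the ring solver.
-- * Second identity: (x+y)⁴ - (x-y)⁴ = 8xy(x²+y²) for all x, y, so any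
--   solution of pq(p²+q²) = a·rs(r²+s²) yields A⁴ + aB⁴ = C⁴ + aD⁴ with
--   A = p+q, B = r-s, C = p-q, D = r+s.

open import Defs
open import Data.Rational using (ℚ; _+_; _*_; _-_; NonZero)
open import Data.Product using (Σ; _×_)
open import Relation.Binary.PropositionalEquality using (_≡_)

open import Data.Rational using (mkℚ; _/_; 1/_; _÷_; ↥_; ↧_; ↧ₙ_; toℚᵘ; ≢-nonZero)
open import Data.Rational.Properties using (toℚᵘ-cong; toℚᵘ-homo-*; *-inverseˡ; *-identityʳ; *-assoc)
import Data.Rational.Unnormalised as ℚᵘ
import Data.Rational.Unnormalised.Properties as ℚᵘ
import Data.Rational.Solver as ℚ-Solver
import Data.Integer as ℤ
import Data.Integer.Properties as ℤ
open import Data.Nat as ℕ using (ℕ)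
open import Data.Nat.Properties using (*-cancelʳ-≡)
open import Data.Nat.Divisibility using (_∣_; divides; _∣?_)
open import Data.Nat.Primality using (Prime; prime?; euclidsLemma)
open import Data.Nat.Coprimality using (Coprime; coprime?)
import Data.Nat.Solver as ℕ-Solver
open import Data.Sum using (inj₁; inj₂; [_,_]′)
open import Data.Product using (_,_)
open import Relation.Nullary using (contradiction)
open import Relation.Nullary.Decidable using (from-yes; from-no; recompute)
open import Relation.Binary.PropositionalEquality using (_≢_; refl; sym; trans; cong; module ≡-Reasoning)
open import Function using (id)

prime∣square⇒prime∣root : ∀ {p} x → Prime p → p ∣ x ℕ.* x → p ∣ x
prime∣square⇒prime∣root x p-prime p∣x² = [ id , id ]′ (euclidsLemma x x p-prime p∣x²)

-- √6 is irrational: no coprime m, n satisfy 6m² = n².  Since n² = 2·3m²,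
-- n = 2k; then 3m² = 2k², so 2 ∣ m as 2 ∤ 3, and 2 divides both m and n.
six-not-square-of-ratio : ∀ m n → Coprime m n → 6 ℕ.* (m ℕ.* m) ≢ n ℕ.* n
six-not-square-of-ratio m n coprime 6m²≡n² = contradiction (coprime (2∣m 2∣n , 2∣n)) λ ()
  where
  open ℕ-Solver.+-*-Solver
  open ≡-Reasoning

  2-prime : Prime 2
  2-prime = from-yes (prime? 2)

  6x≡3x*2 : ∀ x → 6 ℕ.* x ≡ 3 ℕ.* x ℕ.* 2
  6x≡3x*2 = solve 1 (λ x → con 6 :* x := con 3 :* x :* con 2) refl

  2∣n : 2 ∣ n
  2∣n = prime∣square⇒prime∣root n 2-prime
          (divides (3 ℕ.* (m ℕ.* m)) (trans (sym 6m²≡n²) (6x≡3x*2 (m ℕ.* m))))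

  2∣m : 2 ∣ n → 2 ∣ m
  2∣m (divides k n≡k*2) with euclidsLemma 3 (m ℕ.* m) 2-prime (divides (k ℕ.* k) 3m²≡2k²)
    where
    3m²≡2k² : 3 ℕ.* (m ℕ.* m) ≡ (k ℕ.* k) ℕ.* 2
    3m²≡2k² = *-cancelʳ-≡ _ _ 2 (begin
      3 ℕ.* (m ℕ.* m) ℕ.* 2        ≡⟨ sym (6x≡3x*2 (m ℕ.* m)) ⟩
      6 ℕ.* (m ℕ.* m)              ≡⟨ 6m²≡n² ⟩
      n ℕ.* n                      ≡⟨ cong (λ x → x ℕ.* x) n≡k*2 ⟩
      (k ℕ.* 2) ℕ.* (k ℕ.* 2)      ≡⟨ solve 1 (λ k → (k :* con 2) :* (k :* con 2) := (k :* k) :* con 2 :* con 2) refl k ⟩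
      (k ℕ.* k) ℕ.* 2 ℕ.* 2        ∎)
  ... | inj₁ 2∣3  = contradiction 2∣3 (from-no (2 ∣? 3))
  ... | inj₂ 2∣m² = prime∣square⇒prime∣root m 2-prime 2∣m²

-- Cross-multiplying the rational equation 6u² = 1 gives 6·(↥u)² = (↧u)²
-- in ℤ; we pass through unnormalised rationals, where products are
-- computed componentwise.
cross-multiply : ∀ u → c6 * sq u ≡ c1 → ℤ.+ 6 ℤ.* (↥ u ℤ.* ↥ u) ≡ ↧ u ℤ.* ↧ u
cross-multiply u@(mkℚ _ _ _) 6u²≡1 with ℚᵘ.≃-trans (ℚᵘ.≃-sym toℚᵘ-6u²) (toℚᵘ-cong 6u²≡1)
  where
  toℚᵘ-6u² : toℚᵘ (c6 * sq u) ℚᵘ.≃ toℚᵘ c6 ℚᵘ.* (toℚᵘ u ℚᵘ.* toℚᵘ u)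
  toℚᵘ-6u² = ℚᵘ.≃-trans (toℚᵘ-homo-* c6 (sq u)) (ℚᵘ.*-congˡ {toℚᵘ c6} (toℚᵘ-homo-* u u))
... | ℚᵘ.*≡* eq = trans (sym (ℤ.*-identityʳ _)) (trans eq (trans (ℤ.*-identityˡ _) (ℤ.*-identityˡ _)))

six-not-rational-square : ∀ u → c6 * sq u ≢ c1
six-not-rational-square u@(mkℚ _ _ ↥u⊥↧u) 6u²≡1 = six-not-square-of-ratio m n coprime 6m²≡n²
  where
  m n : ℕ
  m = ℤ.∣ ↥ u ∣
  n = ↧ₙ u

  coprime : Coprime m n
  coprime = recompute (coprime? m n) ↥u⊥↧u

  6m²≡n² : 6 ℕ.* (m ℕ.* m) ≡ n ℕ.* n
  6m²≡n² = begin
    6 ℕ.* (m ℕ.* m)                  ≡⟨ cong (6 ℕ.*_) (ℤ.abs-* (↥ u) (↥ u)) ⟨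
    6 ℕ.* ℤ.∣ ↥ u ℤ.* ↥ u ∣          ≡⟨ ℤ.abs-* (ℤ.+ 6) (↥ u ℤ.* ↥ u) ⟨
    ℤ.∣ ℤ.+ 6 ℤ.* (↥ u ℤ.* ↥ u) ∣    ≡⟨ cong ℤ.∣_∣ (cross-multiply u 6u²≡1) ⟩
    ℤ.∣ ↧ u ℤ.* ↧ u ∣                ≡⟨ ℤ.abs-* (↧ u) (↧ u) ⟩
    n ℕ.* n                          ∎
    where open ≡-Reasoning

open ℚ-Solver.+-*-Solver

s-nonZero : ∀ u → NonZero (sOf u)
s-nonZero u = ≢-nonZero {sOf u} λ s≡0 → six-not-rational-square u (begin
  c6 * sq u               ≡⟨ solve 1 (λ u → con c6 :* (u :* u) := con c1 :- (con c1 :- con c6 :* (u :* u))) refl u ⟩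
  c1 - sOf u              ≡⟨ cong (c1 -_) s≡0 ⟩
  c1                      ∎)
  where open ≡-Reasoning

÷-*-cancel : ∀ x y .{{_ : NonZero y}} → (x ÷ y) * y ≡ x
÷-*-cancel x y = begin
  x * 1/ y * y        ≡⟨ *-assoc x (1/ y) y ⟩
  x * (1/ y * y)      ≡⟨ cong (x *_) (*-inverseˡ y) ⟩
  x * c1              ≡⟨ *-identityʳ x ⟩
  x                   ∎
  where open ≡-Reasoning

parametrisation-identity : ∀ u → (c9 * sq u + c16) * (rOf u * (sq (rOf u) + sq (sOf u)))
                                 ≡ pOf u * qOf u * (sq (pOf u) + sq (qOf u))
parametrisation-identity = solve 1 (λ u →
    (con c9 :* (u :* u) :+ con c16) :* (R u :* (R u :* R u :+ S u :* S u))
      := P u :* Q u :* (P u :* P u :+ Q u :* Q u)) refl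
  where
  P Q R S : Polynomial 1 → Polynomial 1
  P u = u :* (con c9 :* (u :* u) :+ con c1)
  Q u = con c9 :* (u :* u) :- con c4
  R u = u :* (con c9 :* (u :* u) :- con c4)
  S u = con c1 :- con c6 :* (u :* u)

quadratic-relation : ∀ u .{{_ : NonZero (sOf u)}} →
  pOf u * qOf u * (sq (pOf u) + sq (qOf u)) ≡ aOf u * rOf u * sOf u * (sq (rOf u) + sq (sOf u))
quadratic-relation u = begin
  pOf u * qOf u * (sq p + sq q)           ≡⟨ parametrisation-identity u ⟨
  (c9 * sq u + c16) * (r * (sq r + sq s)) ≡⟨ cong (_* (r * (sq r + sq s))) (÷-*-cancel (c9 * sq u + c16) s) ⟨
  (a * s) * (r * (sq r + sq s))           ≡⟨ solve 3 (λ a r s → (a :* s) :* (r :* (r :* r :+ s :* s)) := a :* r :* s :* (r :* r :+ s :* s)) refl a r s ⟩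
  a * r * s * (sq r + sq s)               ∎
  where
  open ≡-Reasoning
  p q r s a : ℚ
  p = pOf u
  q = qOf u
  r = rOf u
  s = sOf u
  a = aOf u

c8 : ℚ
c8 = ℤ.+ 8 / 1

-- (x+y)⁴ = (x-y)⁴ + 8xy(x²+y²): the odd-degree terms of the binomial
-- expansion are exactly those that change sign with y.
fourth-of-sum : ∀ x y → fourth (x + y) ≡ fourth (x - y) + c8 * (x * y * (sq x + sq y))
fourth-of-sum = solve 2 (λ x y → F (x :+ y) := F (x :- y) :+ con c8 :* (x :* y :* (x :* x :+ y :* y))) refl
  where
  F : Polynomial 2 → Polynomial 2
  F z = (z :* z) :* (z :* z)

quartic-from-quadratic : ∀ p q r s a → p * q * (sq p + sq q) ≡ a * r * s * (sq r + sq s) →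
  fourth (p + q) + a * fourth (r - s) ≡ fourth (p - q) + a * fourth (r + s)
quartic-from-quadratic p q r s a pq≡ars = begin
  fourth (p + q) + a * fourth (r - s)                                   ≡⟨ cong (_+ a * fourth (r - s)) (fourth-of-sum p q) ⟩
  fourth (p - q) + c8 * (p * q * (sq p + sq q)) + a * fourth (r - s)     ≡⟨ cong (λ t → fourth (p - q) + c8 * t + a * fourth (r - s)) pq≡ars ⟩
  fourth (p - q) + c8 * (a * r * s * (sq r + sq s)) + a * fourth (r - s) ≡⟨ solve 5 (λ p q r s a →
                                                                              F (p :- q) :+ con c8 :* (a :* r :* s :* (r :* r :+ s :* s)) :+ a :* F (r :- s)
                                                                              := F (p :- q) :+ a :* (F (r :- s) :+ con c8 :* (r :* s :* (r :* r :+ s :* s)))) refl p q r s a ⟩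
  fourth (p - q) + a * (fourth (r - s) + c8 * (r * s * (sq r + sq s))) ≡⟨ cong (λ t → fourth (p - q) + a * t) (fourth-of-sum r s) ⟨
  fourth (p - q) + a * fourth (r + s)                                   ∎
  where
  open ≡-Reasoning
  F : Polynomial 5 → Polynomial 5
  F z = (z :* z) :* (z :* z)

mainTheorem9 : (u : ℚ) → Σ (NonZero (sOf u)) λ nz → ((pOf u * qOf u * (sq (pOf u) + sq (qOf u)) ≡ aOf u {{nz}} * rOf u * sOf u * (sq (rOf u) + sq (sOf u))) × (fourth (pOf u + qOf u) + aOf u {{nz}} * fourth (rOf u - sOf u) ≡ fourth (pOf u - qOf u) + aOf u {{nz}} * fourth (rOf u + sOf u)))
mainTheorem9 u = nz , relation , quartic-from-quadratic (pOf u) (qOf u) (rOf u) (sOf u) (aOf u {{nz}}) relation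
  where
  nz : NonZero (sOf u)
  nz = s-nonZero u
  relation : pOf u * qOf u * (sq (pOf u) + sq (qOf u)) ≡ aOf u {{nz}} * rOf u * sOf u * (sq (rOf u) + sq (sOf u))
  relation = quadratic-relation u {{nz}}
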